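{- Let $G$ be a group definable in a structure $M$, and suppose $G$ has a definable classical paradoxical decomposition with attached numbers $m,n$. If $m=2$ or $n=2$, then $\mathrm{Th}(M)$ has the strict order property. In particular, the definable Tarski number of a group which is not definably amenable and is definable in a model of a simple theory is at least $6$.
   Context: A definable classical paradoxical decomposition of $G$ with attached numbers $m,n$ consists of pairwise disjoint subsets $X_1,\dots,X_m,Y_1,\dots,Y_n$ of $G$, definable with parameters in $M$, and elements $g_1,\dots,g_m,h_1,\dots,h_n\in G$ such that $G=\bigcup_{i=1}^m g_iX_i=\bigcup_{j=1}^n h_jY_j$. The definable Tarski number of a non-definably-amenable definable group $G$ is the least value of $m+n$ over all its definable classical paradoxical decompositions ($\infty$ if there is none). $G$ is definably amenable if there is a left-translation-invariant finitely additive probability measure on the definable subsets of $G$. A theory has the strict order property if some definable relation defines a partial order with infinite chains. -}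

module Defs where

open import Level using (0ℓ)
open import Data.Nat using (ℕ; zero; suc; _+_; _≤_; _<_)
open import Data.Fin using (Fin)
open import Data.Vec using (Vec; []; _∷_; _++_)
open import Data.Product using (Σ; Σ-syntax; ∃; ∃-syntax; _×_)
open import Data.Sum using (_⊎_)
open import Data.Empty using (⊥)
open import Relation.Nullary using (¬_)
open import Relation.Binary.PropositionalEquality using (_≡_; _≢_)
open import Function.Bundles using (_⇔_)
open import Function.Definitions using (Injective)

record Signature : Set₁ where
  field
    Func : ℕ → Set
    Rel  : ℕ → Set

module _ (L : Signature) where
  open Signature L

  data Term (n : ℕ) : Set where
    var : Fin n → Term n
    app : ∀ {a} → Func a → Vec (Term n) a → Term n

  -- formulas with free variables among 0 .. n-1 (de Bruijn; ∃f/∀f bind variable 0)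
  data Formula (n : ℕ) : Set where
    atom : ∀ {a} → Rel a → Vec (Term n) a → Formula n
    _≐_  : Term n → Term n → Formula n
    ⊥f   : Formula n
    ¬f_  : Formula n → Formula n
    _∧f_ : Formula n → Formula n → Formula n
    _∨f_ : Formula n → Formula n → Formula n
    ∃f_  : Formula (suc n) → Formula n
    ∀f_  : Formula (suc n) → Formula n

record Structure (L : Signature) : Set₁ where
  open Signature L
  field
    Carrier : Set
    fun     : ∀ {a} → Func a → Vec Carrier a → Carrier
    rel     : ∀ {a} → Rel a → Vec Carrier a → Set

module _ {L : Signature} (M : Structure L) where
  open Structure M

  lookupV : ∀ {n} → Vec Carrier n → Fin n → Carrier
  lookupV (a ∷ v) Fin.zero    = a
  lookupV (a ∷ v) (Fin.suc i) = lookupV v i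

  mutual
    evalTerm : ∀ {n} → Vec Carrier n → Term L n → Carrier
    evalTerm ρ (var i)   = lookupV ρ i
    evalTerm ρ (app f ts) = fun f (evalTerms ρ ts)

    evalTerms : ∀ {n a} → Vec Carrier n → Vec (Term L n) a → Vec Carrier a
    evalTerms ρ []       = []
    evalTerms ρ (t ∷ ts) = evalTerm ρ t ∷ evalTerms ρ ts

  Sat : ∀ {n} → Formula L n → Vec Carrier n → Set
  Sat (atom R ts) ρ = rel R (evalTerms ρ ts)
  Sat (s ≐ t)    ρ = evalTerm ρ s ≡ evalTerm ρ t
  Sat ⊥f         ρ = ⊥
  Sat (¬f φ)     ρ = ¬ Sat φ ρ
  Sat (φ ∧f ψ)   ρ = Sat φ ρ × Sat ψ ρ
  Sat (φ ∨f ψ)   ρ = Sat φ ρ ⊎ Sat ψ ρ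
  Sat (∃f φ)     ρ = Σ[ a ∈ Carrier ] Sat φ (a ∷ ρ)
  Sat (∀f φ)     ρ = (a : Carrier) → Sat φ (a ∷ ρ)

  Tuple : ℕ → Set
  Tuple k = Vec Carrier k

  Definable : (k : ℕ) → (Tuple k → Set) → Set
  Definable k X =
    Σ[ p ∈ ℕ ] Σ[ φ ∈ Formula L (k + p) ] Σ[ c ∈ Tuple p ]
      ((x : Tuple k) → X x ⇔ Sat φ (x ++ c))

  record DefinableGroup (k : ℕ) : Set₁ where
    field
      G     : Tuple k → Set
      _·_   : Tuple k → Tuple k → Tuple k
      e     : Tuple k
      inv   : Tuple k → Tuple k
      ·-closed   : ∀ {x y} → G x → G y → G (x · y)
      e-in       : G e
      inv-closed : ∀ {x} → G x → G (inv x)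
      assoc      : ∀ {x y z} → G x → G y → G z → (x · y) · z ≡ x · (y · z)
      identityˡ  : ∀ {x} → G x → e · x ≡ x
      identityʳ  : ∀ {x} → G x → x · e ≡ x
      inverseˡ   : ∀ {x} → G x → inv x · x ≡ e
      inverseʳ   : ∀ {x} → G x → x · inv x ≡ e
      G-definable : Definable k G
      graph-definable :
        Σ[ p ∈ ℕ ] Σ[ φ ∈ Formula L (k + (k + (k + p))) ] Σ[ c ∈ Tuple p ]
          ((x y z : Tuple k) →
             (G x × G y × z ≡ x · y) ⇔ Sat φ (x ++ (y ++ (z ++ c))))

  module _ {k : ℕ} (𝔾 : DefinableGroup k) where
    open DefinableGroup 𝔾

    record ParadoxicalDecomposition (m n : ℕ) : Set₁ where
      field
        X : Fin m → Tuple k → Set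
        Y : Fin n → Tuple k → Set
        X-definable : ∀ i → Definable k (X i)
        Y-definable : ∀ j → Definable k (Y j)
        X⊆G : ∀ i {x} → X i x → G x
        Y⊆G : ∀ j {x} → Y j x → G x
        XX-disjoint : ∀ i i' {x} → i ≢ i' → X i x → X i' x → ⊥
        YY-disjoint : ∀ j j' {x} → j ≢ j' → Y j x → Y j' x → ⊥
        XY-disjoint : ∀ i j {x} → X i x → Y j x → ⊥
        g : Fin m → Tuple k
        h : Fin n → Tuple k
        g∈G : ∀ i → G (g i)
        h∈G : ∀ j → G (h j)
        cover-X : ∀ x → G x ⇔ (Σ[ i ∈ Fin m ] Σ[ y ∈ Tuple k ] (X i y × x ≡ g i · y))
        cover-Y : ∀ x → G x ⇔ (Σ[ j ∈ Fin n ] Σ[ y ∈ Tuple k ] (Y j y × x ≡ h j · y))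

    -- "the definable Tarski number of G is at least t":
    -- every definable classical paradoxical decomposition has m + n ≥ t
    -- (vacuous if there is none, i.e. Tarski number ∞)
    DefTarskiNumber≥ : ℕ → Set₁
    DefTarskiNumber≥ t = ∀ m n → ParadoxicalDecomposition m n → t ≤ m + n

  -- Some relation on M^r definable (with parameters) is a partial order
  -- having chains of every finite length (by compactness this is exactly
  -- "defines, in a model of Th(M), a partial order with an infinite chain").

  SOP : Set
  SOP =
    Σ[ r ∈ ℕ ] Σ[ p ∈ ℕ ] Σ[ φ ∈ Formula L (r + (r + p)) ] Σ[ c ∈ Tuple p ]
      let _⊑_ : Tuple r → Tuple r → Set
          a ⊑ b = Sat φ (a ++ (b ++ c))
      in ((a : Tuple r) → a ⊑ a)
       × ((a b : Tuple r) → a ⊑ b → b ⊑ a → a ≡ b)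
       × ((a b d : Tuple r) → a ⊑ b → b ⊑ d → a ⊑ d)
       × ((N : ℕ) → Σ[ ch ∈ (Fin N → Tuple r) ]
            (∀ (i j : Fin N) → Data.Fin._<_ i j → (ch i ⊑ ch j) × ch i ≢ ch j))

  -- Simplicity of Th(M): no formula has the tree property.
  -- Nodes of the tree w^{<ω} are coded as vectors listing the entries
  -- most-recent-first, so the children of s are (i ∷ s).

  branch : ∀ {w} → (ℕ → Fin w) → (l : ℕ) → Vec (Fin w) l
  branch η zero    = []
  branch η (suc l) = η l ∷ branch η l

  -- Tree property of φ(x;y) (parameter-free, |x| = a, |y| = b) with respect
  -- to k ≥ 2, in its finitary form (equivalent by compactness): for every
  -- depth d and width w there are parameters b_s (s ∈ w^{≤d}) such that every
  -- branch {φ(x,b_{η|l}) : l ≤ d} is realised and for every node s of depth < d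
  -- the set {φ(x,b_{s⌢i}) : i < w} is k-inconsistent.
  TreeProperty : (a b : ℕ) → Formula L (a + b) → ℕ → Set
  TreeProperty a b φ k =
    2 ≤ k ×
    ((d w : ℕ) →
      Σ[ B ∈ (∀ {l} → Vec (Fin w) l → Tuple b) ]
        (((η : ℕ → Fin w) →
            Σ[ x ∈ Tuple a ] ((l : ℕ) → l ≤ d → Sat φ (x ++ B (branch η l))))
        × ((l : ℕ) → l < d → (s : Vec (Fin w) l) →
            (t : Fin k → Fin w) → Injective _≡_ _≡_ t →
            ¬ (Σ[ x ∈ Tuple a ] ((i : Fin k) → Sat φ (x ++ B (t i ∷ s)))))))

  Simple : Set
  Simple = ∀ a b (φ : Formula L (a + b)) k → ¬ TreeProperty a b φ k

module Submission where

-- If G = g₀X₀ ∪ g₁X₁ with X₀, X₁ disjoint and some b ∈ G outside both (any point of the other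
-- half of the decomposition), then a = g₁⁻¹g₀ maps Z = G ∖ X₀ into X₁ ⊆ Z while b ∈ Z ∖ aZ.
-- So the uniformly definable translates aⁿZ strictly decrease, and strict reverse inclusion of
-- translates is a definable partial order with infinite chains.  Conversely, a definable partial
-- order with arbitrarily long finite chains gives a ⊑ x ∧ ¬ b ⊑ x the tree property: the nodes
-- of a tree become nested half-open intervals of a chain, siblings disjoint.  Finally every half of
-- a paradoxical decomposition has at least two pieces (one translate gX covering G forces X = G),
-- so in a simple theory m, n ≥ 3.

open import Level using (0ℓ)
open import Data.Nat
  using (ℕ; zero; suc; _+_; _*_; _^_; _∸_; _≤_; _<_; _≤′_; ≤′-refl; ≤′-step; s≤s; z≤n; z<s)
open import Data.Nat.Properties
  using (_≟_; ≤-refl; ≤-trans; <⇒≤; <-≤-trans; ≤∧≢⇒<; m≤n⇒m<n∨m≡n; <-cmp; ≤⇒≤′;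
         +-assoc; +-comm; +-mono-≤; +-monoʳ-≤; *-monoˡ-≤; m≤m+n; m<m+n; n∸n≡0; +-∸-assoc;
         module ≤-Reasoning)
open import Data.Nat.DivMod using (_mod_; m≤n⇒m%n≡m)
open import Data.Fin using (Fin; zero; suc; toℕ; _↑ˡ_; _↑ʳ_; lift; splitAt)
open import Data.Fin.Properties using (toℕ-fromℕ<; toℕ-injective; toℕ<n)
open import Data.Vec using (Vec; []; _∷_; _++_)
open import Data.Vec.Functional using () renaming (_++_ to _⊕_)
open import Data.Product using (Σ; Σ-syntax; ∃; _×_; _,_; proj₁; proj₂)
open import Data.Product.Function.NonDependent.Propositional using (_×-⇔_)
open import Data.Product.Function.Dependent.Propositional using (Σ-⇔)
open import Data.Sum using (_⊎_; inj₁; inj₂)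
open import Data.Sum.Function.Propositional using (_⊎-⇔_)
open import Data.Sum.Properties using ([,]-map)
open import Data.Empty using (⊥; ⊥-elim)
open import Function using (_∘_)
open import Function.Definitions using (Injective)
open import Function.Bundles using (_⇔_; mk⇔; Equivalence)
open import Function.Construct.Identity using (↠-id)
open import Function.Properties.Equivalence
  using () renaming (refl to ⇔-refl; sym to ⇔-sym; trans to ⇔-trans)
open import Function.Related.TypeIsomorphisms using (¬-cong-⇔)
open import Relation.Nullary using (¬_; yes; no)
open import Relation.Binary using (IsPartialOrder; Transitive; tri<; tri≈; tri>)
open import Relation.Binary.PropositionalEquality
  using (_≡_; _≢_; refl; sym; trans; cong; cong₂; subst; subst₂; isEquivalence; module ≡-Reasoning)
open import Axiom.ExcludedMiddle using (ExcludedMiddle)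
open import Defs

open Equivalence using (to; from)

module _ {A : Set} where

  -- Containment is phrased as "no point of Q lies outside P", the meaning of a first-order
  -- formula that needs no excluded middle.
  _⊋_ : (P Q : A → Set) → Set
  P ⊋ Q = ¬ (∃ λ x → Q x × ¬ P x) × (∃ λ x → P x × ¬ Q x)

  ⊋-trans : Transitive _⊋_
  ⊋-trans (Q⊆P , x , Px , ¬Qx) (R⊆Q , _) =
    (λ (y , Ry , ¬Py) → R⊆Q (y , Ry , λ Qy → Q⊆P (y , Qy , ¬Py))) ,
    (x , Px , λ Rx → R⊆Q (x , Rx , ¬Qx))

  ⊋-irrefl : ∀ {P} → ¬ (P ⊋ P)
  ⊋-irrefl (_ , x , Px , ¬Px) = ¬Px Px

_≼⟨_⟩_ : {I A : Set} → I → (I → A → Set) → I → Set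
i ≼⟨ T ⟩ j = i ≡ j ⊎ T i ⊋ T j

≼-isPartialOrder : {I A : Set} (T : I → A → Set) → IsPartialOrder _≡_ (λ i j → i ≼⟨ T ⟩ j)
≼-isPartialOrder T = record
  { isPreorder = record { isEquivalence = isEquivalence ; reflexive = inj₁ ; trans = ≼-trans }
  ; antisym    = ≼-antisym
  }
  where
  ≼-trans : Transitive (λ i j → i ≼⟨ T ⟩ j)
  ≼-trans (inj₁ refl) q           = q
  ≼-trans (inj₂ p)    (inj₁ refl) = inj₂ p
  ≼-trans (inj₂ p)    (inj₂ q)    = inj₂ (⊋-trans p q)
  ≼-antisym : ∀ {i j} → i ≼⟨ T ⟩ j → j ≼⟨ T ⟩ i → i ≡ j
  ≼-antisym (inj₁ i≡j) _           = i≡j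
  ≼-antisym (inj₂ _)   (inj₁ j≡i)  = sym j≡i
  ≼-antisym (inj₂ p)   (inj₂ q)    = ⊥-elim (⊋-irrefl (⊋-trans p q))

LongChains : {A : Set} → (A → A → Set) → Set
LongChains {A} _⊑_ =
  (N : ℕ) → Σ[ ch ∈ (Fin N → A) ] (∀ i j → i Data.Fin.< j → ch i ⊑ ch j × ch i ≢ ch j)

stepwise⇒< : {A : Set} {R : A → A → Set} → Transitive R → (v : ℕ → A) →
             (∀ n → R (v n) (v (suc n))) → ∀ {i j} → i < j → R (v i) (v j)
stepwise⇒< {R = R} R-trans v step {i} i<j = go (≤⇒≤′ i<j)
  where
  go : ∀ {j} → suc i ≤′ j → R (v i) (v j)
  go ≤′-refl       = step i
  go (≤′-step i<j) = R-trans (go i<j) (step _)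

module Intervals {A : Set} {_⊑_ : A → A → Set} (po : IsPartialOrder _≡_ _⊑_)
                 (K : ℕ) (ch : ℕ → A)
                 (increasing : ∀ {i j} → i < j → j ≤ K → ch i ⊑ ch j × ch i ≢ ch j) where
  open IsPartialOrder po using (antisym) renaming (refl to ⊑-refl; trans to ⊑-trans)

  ch-mono : ∀ {i j} → i ≤ j → j ≤ K → ch i ⊑ ch j
  ch-mono i≤j j≤K with m≤n⇒m<n∨m≡n i≤j
  ... | inj₁ i<j  = proj₁ (increasing i<j j≤K)
  ... | inj₂ refl = ⊑-refl

  _∈[_,_⟩ : A → ℕ → ℕ → Set
  x ∈[ i , j ⟩ = ch i ⊑ x × ¬ ch j ⊑ x

  ch∈[,⟩ : ∀ {i l j} → i ≤ l → l < j → j ≤ K → ch l ∈[ i , j ⟩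
  ch∈[,⟩ i≤l l<j j≤K =
    ch-mono i≤l (≤-trans (<⇒≤ l<j) j≤K) ,
    λ ch-j⊑ch-l → proj₂ (increasing l<j j≤K) (antisym (proj₁ (increasing l<j j≤K)) ch-j⊑ch-l)

  [,⟩-disjoint : ∀ {i j i′ j′ x} → j ≤ i′ → i′ ≤ K → x ∈[ i , j ⟩ → x ∈[ i′ , j′ ⟩ → ⊥
  [,⟩-disjoint j≤i′ i′≤K (_ , ch-j⋢x) (ch-i′⊑x , _) =
    ch-j⋢x (⊑-trans (ch-mono j≤i′ i′≤K) ch-i′⊑x)

-- A node s of depth l ≤ d of the w-branching tree is coded by the interval [lo s, hi s) of
-- length w^(d-l); the w children of s cut it into consecutive blocks.
module TreeCoding (d w : ℕ) where

  width : ℕ → ℕ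
  width l = w ^ (d ∸ l)

  lo : ∀ {l} → Vec (Fin w) l → ℕ
  lo []              = 0
  lo {suc l} (t ∷ s) = lo s + toℕ t * width (suc l)

  hi : ∀ {l} → Vec (Fin w) l → ℕ
  hi {l} s = lo s + width l

  hi-∷ : ∀ {l} (t : Fin w) (s : Vec (Fin w) l) → hi (t ∷ s) ≡ lo s + suc (toℕ t) * width (suc l)
  hi-∷ {l} t s = trans (+-assoc (lo s) _ _) (cong (lo s +_) (+-comm (toℕ t * width (suc l)) _))

  lo≤hi : ∀ {l} (s : Vec (Fin w) l) → lo s ≤ hi s
  lo≤hi s = m≤m+n _ _

  lo≤lo-child : ∀ {l} (t : Fin w) (s : Vec (Fin w) l) → lo s ≤ lo (t ∷ s)
  lo≤lo-child t s = m≤m+n _ _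

  hi-child≤hi : ∀ {l} → l < d → (t : Fin w) (s : Vec (Fin w) l) → hi (t ∷ s) ≤ hi s
  hi-child≤hi {l} l<d t s = begin
    hi (t ∷ s)                          ≡⟨ hi-∷ t s ⟩
    lo s + suc (toℕ t) * width (suc l)  ≤⟨ +-monoʳ-≤ (lo s) (*-monoˡ-≤ (width (suc l)) (toℕ<n t)) ⟩
    lo s + w * width (suc l)            ≡⟨ cong (λ e → lo s + w ^ e) (+-∸-assoc 1 l<d) ⟨
    hi s                                ∎
    where open ≤-Reasoning

  hi≤lo-sibling : ∀ {l} {t t′ : Fin w} (s : Vec (Fin w) l) → toℕ t < toℕ t′ →
                  hi (t ∷ s) ≤ lo (t′ ∷ s)
  hi≤lo-sibling {l} {t} {t′} s t<t′ = begin
    hi (t ∷ s)                          ≡⟨ hi-∷ t s ⟩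
    lo s + suc (toℕ t) * width (suc l)  ≤⟨ +-monoʳ-≤ (lo s) (*-monoˡ-≤ (width (suc l)) t<t′) ⟩
    lo (t′ ∷ s)                         ∎
    where open ≤-Reasoning

  hi≤w^d : ∀ {l} (s : Vec (Fin w) l) → l ≤ d → hi s ≤ w ^ d
  hi≤w^d []      _   = ≤-refl
  hi≤w^d (t ∷ s) l<d = ≤-trans (hi-child≤hi l<d t s) (hi≤w^d s (<⇒≤ l<d))

  lo<hi-leaf : (s : Vec (Fin w) d) → lo s < hi s
  lo<hi-leaf s = subst (λ e → lo s < lo s + w ^ e) (sym (n∸n≡0 d)) (m<m+n (lo s) z<s)

module _ {L : Signature} where

  mutual
    renameTerm : ∀ {m n} → (Fin m → Fin n) → Term L m → Term L n
    renameTerm f (var i)    = var (f i)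
    renameTerm f (app g ts) = app g (renameTerms f ts)

    renameTerms : ∀ {m n a} → (Fin m → Fin n) → Vec (Term L m) a → Vec (Term L n) a
    renameTerms f []       = []
    renameTerms f (t ∷ ts) = renameTerm f t ∷ renameTerms f ts

  rename : ∀ {m n} → (Fin m → Fin n) → Formula L m → Formula L n
  rename f (atom R ts) = atom R (renameTerms f ts)
  rename f (s ≐ t)     = renameTerm f s ≐ renameTerm f t
  rename f ⊥f          = ⊥f
  rename f (¬f φ)      = ¬f rename f φ
  rename f (φ ∧f ψ)    = rename f φ ∧f rename f ψ
  rename f (φ ∨f ψ)    = rename f φ ∨f rename f ψ
  rename f (∃f φ)      = ∃f rename (lift 1 f) φ
  rename f (∀f φ)      = ∀f rename (lift 1 f) φ

  ∃ⁿ : ∀ k {n} → Formula L (k + n) → Formula L n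
  ∃ⁿ zero    φ = φ
  ∃ⁿ (suc k) φ = ∃ⁿ k (∃f φ)

  _≐ⁿ_ : ∀ {r n} → (Fin r → Fin n) → (Fin r → Fin n) → Formula L n
  _≐ⁿ_ {zero}  f g = ¬f ⊥f
  _≐ⁿ_ {suc r} f g = (var (f zero) ≐ var (g zero)) ∧f ((f ∘ suc) ≐ⁿ (g ∘ suc))

module _ {L : Signature} (M : Structure L) where
  open Structure M

  record Occurs {n m} (u : Tuple M n) (f : Fin n → Fin m) (ρ : Tuple M m) : Set where
    constructor occurs
    field lookup-occurs : ∀ i → lookupV M ρ (f i) ≡ lookupV M u i
  open Occurs

  occurs-++ˡ : ∀ {m n} (u : Tuple M m) (v : Tuple M n) → Occurs u (_↑ˡ n) (u ++ v)
  occurs-++ˡ []      v = occurs λ ()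
  occurs-++ˡ (x ∷ u) v = occurs λ { zero → refl ; (suc i) → lookup-occurs (occurs-++ˡ u v) i }

  occurs-++ʳ : ∀ {m n} (u : Tuple M m) (v : Tuple M n) → Occurs v (m ↑ʳ_) (u ++ v)
  occurs-++ʳ []      v = occurs λ _ → refl
  occurs-++ʳ (x ∷ u) v = occurs (lookup-occurs (occurs-++ʳ u v))

  occurs-∘ : ∀ {l m n} {ρ : Tuple M m} {u : Tuple M n} {w : Tuple M l} {f g} →
             Occurs u f ρ → Occurs w g u → Occurs w (f ∘ g) ρ
  occurs-∘ o p = occurs λ i → trans (lookup-occurs o _) (lookup-occurs p i)

  occurs-⊕ : ∀ {a b m} {ρ : Tuple M m} {u : Tuple M a} {v : Tuple M b} {f g} →
             Occurs u f ρ → Occurs v g ρ → Occurs (u ++ v) (f ⊕ g) ρ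
  occurs-⊕ {u = []}    o p = p
  occurs-⊕ {a = suc a} {ρ = ρ} {u = x ∷ u} o p = occurs λ
    { zero    → lookup-occurs o zero
    ; (suc i) → trans (cong (lookupV M ρ) ([,]-map (splitAt a i)))
                      (lookup-occurs (occurs-⊕ {u = u} (occurs (lookup-occurs o ∘ suc)) p) i) }

  occurs-lift : ∀ {m n} {ρ : Tuple M m} {u : Tuple M n} {f} {x} →
                Occurs u f ρ → Occurs (x ∷ u) (lift 1 f) (x ∷ ρ)
  occurs-lift o = occurs λ { zero → refl ; (suc i) → lookup-occurs o i }

  mutual
    evalTerm-rename : ∀ {m n} {ρ : Tuple M m} {u : Tuple M n} {f} → Occurs u f ρ →
                      (t : Term L n) → evalTerm M ρ (renameTerm f t) ≡ evalTerm M u t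
    evalTerm-rename o (var i)    = lookup-occurs o i
    evalTerm-rename o (app g ts) = cong (fun g) (evalTerms-rename o ts)

    evalTerms-rename : ∀ {m n a} {ρ : Tuple M m} {u : Tuple M n} {f} → Occurs u f ρ →
                       (ts : Vec (Term L n) a) → evalTerms M ρ (renameTerms f ts) ≡ evalTerms M u ts
    evalTerms-rename o []       = refl
    evalTerms-rename o (t ∷ ts) = cong₂ _∷_ (evalTerm-rename o t) (evalTerms-rename o ts)

  Sat-rename : ∀ {m n} {ρ : Tuple M m} {u : Tuple M n} {f} → Occurs u f ρ →
               (φ : Formula L n) → Sat M (rename f φ) ρ ⇔ Sat M φ u
  Sat-rename o (atom R ts) = mk⇔ (subst (rel R) e) (subst (rel R) (sym e))
    where e = evalTerms-rename o ts
  Sat-rename o (s ≐ t)     = mk⇔ (subst₂ _≡_ eˢ eᵗ) (subst₂ _≡_ (sym eˢ) (sym eᵗ))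
    where eˢ = evalTerm-rename o s
          eᵗ = evalTerm-rename o t
  Sat-rename o ⊥f          = ⇔-refl
  Sat-rename o (¬f φ)      = ¬-cong-⇔ (Sat-rename o φ)
  Sat-rename o (φ ∧f ψ)    = Sat-rename o φ ×-⇔ Sat-rename o ψ
  Sat-rename o (φ ∨f ψ)    = Sat-rename o φ ⊎-⇔ Sat-rename o ψ
  Sat-rename o (∃f φ)      = Σ-⇔ (↠-id _) (Sat-rename (occurs-lift o) φ)
  Sat-rename o (∀f φ)      = mk⇔ (λ s x → to (Sat-rename (occurs-lift o) φ) (s x))
                                 (λ s x → from (Sat-rename (occurs-lift o) φ) (s x))

  Sat-∃ⁿ : ∀ k {n} (φ : Formula L (k + n)) (ρ : Tuple M n) →
           Sat M (∃ⁿ k φ) ρ ⇔ (Σ[ x ∈ Tuple M k ] Sat M φ (x ++ ρ))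
  Sat-∃ⁿ zero    φ ρ = mk⇔ ([] ,_) (λ { ([] , s) → s })
  Sat-∃ⁿ (suc k) φ ρ = mk⇔
    (λ s → let (x , a , t) = to (Sat-∃ⁿ k (∃f φ) ρ) s in a ∷ x , t)
    (λ { (a ∷ x , t) → from (Sat-∃ⁿ k (∃f φ) ρ) (x , a , t) })

  Sat-≐ⁿ : ∀ {r m} {ρ : Tuple M m} {a b : Tuple M r} {f g} →
           Occurs a f ρ → Occurs b g ρ → Sat M (f ≐ⁿ g) ρ ⇔ (a ≡ b)
  Sat-≐ⁿ {a = []}    {[]}    o p = mk⇔ (λ _ → refl) (λ _ ())
  Sat-≐ⁿ {a = x ∷ a} {y ∷ b} o p = mk⇔
    (λ (e , s) → cong₂ _∷_ (trans (sym (lookup-occurs o zero)) (trans e (lookup-occurs p zero)))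
                           (to tails s))
    (λ { refl → trans (lookup-occurs o zero) (sym (lookup-occurs p zero)) , from tails refl })
    where tails = Sat-≐ⁿ (occurs (lookup-occurs o ∘ suc)) (occurs (lookup-occurs p ∘ suc))

  record DefinableRel (j k : ℕ) (R : Tuple M j → Tuple M k → Set) : Set₁ where
    field
      {arity} : ℕ
      formula : Formula L (j + (k + arity))
      params  : Tuple M arity
      defines : ∀ a x → R a x ⇔ Sat M formula (a ++ (x ++ params))

  definable-∖ : ∀ {k} {X Y : Tuple M k → Set} → Definable M k X → Definable M k Y →
                Definable M k (λ x → X x × ¬ Y x)
  definable-∖ {k} (p , φ , c , X⇔) (q , ψ , d , Y⇔) =
    p + q , rename (at-x ⊕ at-c) φ ∧f (¬f rename (at-x ⊕ at-d) ψ) , c ++ d ,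
    λ x → ⇔-sym (⇔-trans (Sat-rename (occurs-⊕ (occurs-++ˡ x _) (occurs-c x)) φ) (⇔-sym (X⇔ x))
             ×-⇔ ¬-cong-⇔ (⇔-trans (Sat-rename (occurs-⊕ (occurs-++ˡ x _) (occurs-d x)) ψ)
                                    (⇔-sym (Y⇔ x))))
    where
    at-x : Fin k → Fin (k + (p + q))
    at-x i = i ↑ˡ (p + q)
    at-c : Fin p → Fin (k + (p + q))
    at-c i = k ↑ʳ (i ↑ˡ q)
    at-d : Fin q → Fin (k + (p + q))
    at-d i = k ↑ʳ (p ↑ʳ i)
    occurs-c : ∀ x → Occurs c at-c (x ++ (c ++ d))
    occurs-c x = occurs-∘ (occurs-++ʳ x _) (occurs-++ˡ c d)
    occurs-d : ∀ x → Occurs d at-d (x ++ (c ++ d))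
    occurs-d x = occurs-∘ (occurs-++ʳ x _) (occurs-++ʳ c d)

-- Definable orders and the strict order property

module _ {L : Signature} {M : Structure L} {j k : ℕ} {R : Tuple M j → Tuple M k → Set}
         (D : DefinableRel M j k R) where
  open DefinableRel D

  private
    n : ℕ
    n = j + (j + arity)

  at₁ : Fin j → Fin n
  at₁ i = i ↑ˡ (j + arity)

  at₂ : Fin j → Fin n
  at₂ i = j ↑ʳ (i ↑ˡ arity)

  occurs₁ : ∀ a b → Occurs M a at₁ (a ++ (b ++ params))
  occurs₁ a b = occurs-++ˡ M a _

  occurs₂ : ∀ a b → Occurs M b at₂ (a ++ (b ++ params))
  occurs₂ a b = occurs-∘ M (occurs-++ʳ M a _) (occurs-++ˡ M b params)

  at-params : Fin arity → Fin (k + n)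
  at-params i = k ↑ʳ (j ↑ʳ (j ↑ʳ i))

  R-at : (Fin j → Fin n) → Formula L (k + n)
  R-at pos = rename (((k ↑ʳ_) ∘ pos) ⊕ ((_↑ˡ n) ⊕ at-params)) formula

  Sat-R-at : ∀ (a b : Tuple M j) {d pos} (x : Tuple M k) → Occurs M d pos (a ++ (b ++ params)) →
             Sat M (R-at pos) (x ++ (a ++ (b ++ params))) ⇔ R d x
  Sat-R-at a b {d} x o = ⇔-trans
    (Sat-rename M (occurs-⊕ M (occurs-∘ M (occurs-++ʳ M x _) o)
                              (occurs-⊕ M (occurs-++ˡ M x _) occurs-params)) formula)
    (⇔-sym (defines d x))
    where
    occurs-params : Occurs M params at-params (x ++ (a ++ (b ++ params)))
    occurs-params = occurs-∘ M (occurs-++ʳ M x _)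
                               (occurs-∘ M (occurs-++ʳ M a _) (occurs-++ʳ M b params))

  difference : (Fin j → Fin n) → (Fin j → Fin n) → Formula L (k + n)
  difference p q = R-at p ∧f (¬f R-at q)

  Sat-difference : ∀ (a b : Tuple M j) {e e′ p q} (x : Tuple M k) →
                   Occurs M e p (a ++ (b ++ params)) → Occurs M e′ q (a ++ (b ++ params)) →
                   Sat M (difference p q) (x ++ (a ++ (b ++ params))) ⇔ (R e x × ¬ R e′ x)
  Sat-difference a b x o o′ = Sat-R-at a b x o ×-⇔ ¬-cong-⇔ (Sat-R-at a b x o′)

  Sat-∃-difference : ∀ (a b : Tuple M j) {e e′ p q} →
                     Occurs M e p (a ++ (b ++ params)) → Occurs M e′ q (a ++ (b ++ params)) →
                     Sat M (∃ⁿ k (difference p q)) (a ++ (b ++ params))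
                       ⇔ (∃ λ x → R e x × ¬ R e′ x)
  Sat-∃-difference a b o o′ =
    ⇔-trans (Sat-∃ⁿ M k _ _) (Σ-⇔ (↠-id _) λ {x} → Sat-difference a b x o o′)

  ≼-definable : DefinableRel M j j (λ a b → a ≼⟨ R ⟩ b)
  ≼-definable = record
    { formula = (at₁ ≐ⁿ at₂)
                ∨f ((¬f ∃ⁿ k (difference at₂ at₁)) ∧f ∃ⁿ k (difference at₁ at₂))
    ; params  = params
    ; defines = λ a b → ⇔-sym (Sat-≐ⁿ M (occurs₁ a b) (occurs₂ a b)
                         ⊎-⇔ (¬-cong-⇔ (Sat-∃-difference a b (occurs₂ a b) (occurs₁ a b))
                         ×-⇔ Sat-∃-difference a b (occurs₁ a b) (occurs₂ a b)))
    }

module _ {L : Signature} {M : Structure L} where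

  definable-order⇒SOP : ∀ {r} {_⊑_ : Tuple M r → Tuple M r → Set} →
    DefinableRel M r r _⊑_ → IsPartialOrder _≡_ _⊑_ →
    LongChains _⊑_ →
    SOP M
  definable-order⇒SOP {r} D po chains =
    r , arity , formula , params ,
    (λ a → to (defines a a) ⊑-refl) ,
    (λ a b a⊑b b⊑a → ⊑-antisym (from (defines a b) a⊑b) (from (defines b a) b⊑a)) ,
    (λ a b c a⊑b b⊑c →
       to (defines a c) (⊑-trans (from (defines a b) a⊑b) (from (defines b c) b⊑c))) ,
    λ N → let (ch , increasing) = chains N in
      ch , λ i j i<j → let (ch-i⊑ch-j , ch-i≢ch-j) = increasing i j i<j in
                       to (defines _ _) ch-i⊑ch-j , ch-i≢ch-j
    where
    open DefinableRel D
    open IsPartialOrder po renaming (refl to ⊑-refl; antisym to ⊑-antisym; trans to ⊑-trans)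

  descending⇒SOP : ∀ {j k} {T : Tuple M j → Tuple M k → Set} → DefinableRel M j k T →
                   (v : ℕ → Tuple M j) → (∀ n → T (v n) ⊋ T (v (suc n))) → SOP M
  descending⇒SOP {T = T} D v step = definable-order⇒SOP (≼-definable D) (≼-isPartialOrder T) chains
    where
    chains : LongChains (λ a b → a ≼⟨ T ⟩ b)
    chains N = v ∘ toℕ , λ i j i<j →
      let shrinks = stepwise⇒< {R = λ a b → T a ⊋ T b} ⊋-trans v step i<j in
      inj₂ shrinks , λ vi≡vj → ⊋-irrefl (subst (λ z → T (v (toℕ i)) ⊋ T z) (sym vi≡vj) shrinks)

-- The strict order property yields the tree property

module _ {L : Signature} {M : Structure L} {r : ℕ} {_⊑_ : Tuple M r → Tuple M r → Set}
         (D : DefinableRel M r r _⊑_) where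
  open DefinableRel D

  interval-formula : Formula L (r + (r + (r + arity)))
  interval-formula = difference D (at₁ D) (at₂ D)

  module _ (po : IsPartialOrder _≡_ _⊑_)
           (chains : LongChains _⊑_) (d w : ℕ) where
    open TreeCoding d w

    private
      K : ℕ
      K = w ^ d

      -- indices beyond K wrap around; only i ≤ K is used
      ch : ℕ → Tuple M r
      ch i = proj₁ (chains (suc K)) (i mod suc K)

      toℕ-mod : ∀ {i} → i ≤ K → toℕ (i mod suc K) ≡ i
      toℕ-mod i≤K = trans (toℕ-fromℕ< _) (m≤n⇒m%n≡m i≤K)

      increasing : ∀ {i j} → i < j → j ≤ K → ch i ⊑ ch j × ch i ≢ ch j
      increasing i<j j≤K = proj₂ (chains (suc K)) _ _
        (subst₂ _<_ (sym (toℕ-mod (≤-trans (<⇒≤ i<j) j≤K))) (sym (toℕ-mod j≤K)) i<j)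

    open Intervals po K ch increasing

    node-params : ∀ {l} → Vec (Fin w) l → Tuple M (r + (r + arity))
    node-params s = ch (lo s) ++ (ch (hi s) ++ params)

    Sat-interval-formula : ∀ x {l} (s : Vec (Fin w) l) →
                           Sat M interval-formula (x ++ node-params s) ⇔ x ∈[ lo s , hi s ⟩
    Sat-interval-formula x s = Sat-difference D (ch (lo s)) (ch (hi s)) x
      (occurs₁ D (ch (lo s)) (ch (hi s))) (occurs₂ D (ch (lo s)) (ch (hi s)))

    branch-nested : (η : ℕ → Fin w) → ∀ {l l′} → l ≤ l′ → l′ ≤ d →
                    lo (branch M η l) ≤ lo (branch M η l′) × hi (branch M η l′) ≤ hi (branch M η l)
    branch-nested η {l} l≤l′ = go (≤⇒≤′ l≤l′)
      where
      go : ∀ {l′} → l ≤′ l′ → l′ ≤ d →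
           lo (branch M η l) ≤ lo (branch M η l′) × hi (branch M η l′) ≤ hi (branch M η l)
      go ≤′-refl             _    = ≤-refl , ≤-refl
      go (≤′-step {l′} l≤l′) l′<d = let (lo≤ , hi≥) = go l≤l′ (<⇒≤ l′<d) in
        ≤-trans lo≤ (lo≤lo-child (η l′) (branch M η l′)) ,
        ≤-trans (hi-child≤hi l′<d (η l′) (branch M η l′)) hi≥

    branch-realised : (η : ℕ → Fin w) → Σ[ x ∈ Tuple M r ]
                      ((l : ℕ) → l ≤ d → Sat M interval-formula (x ++ node-params (branch M η l)))
    branch-realised η = ch (lo leaf) , λ l l≤d →
      let (lo≤ , hi≥) = branch-nested η l≤d ≤-refl in
      from (Sat-interval-formula _ (branch M η l))
           (ch∈[,⟩ lo≤ (<-≤-trans (lo<hi-leaf leaf) hi≥) (hi≤w^d (branch M η l) l≤d))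
      where leaf = branch M η d

    siblings-disjoint : ∀ {l} → l < d → (s : Vec (Fin w) l) {t t′ : Fin w} → toℕ t < toℕ t′ →
                        ∀ x → Sat M interval-formula (x ++ node-params (t ∷ s)) →
                        Sat M interval-formula (x ++ node-params (t′ ∷ s)) → ⊥
    siblings-disjoint l<d s {t} {t′} t<t′ x x∈t x∈t′ =
      [,⟩-disjoint {i = lo (t ∷ s)} {j′ = hi (t′ ∷ s)}
        (hi≤lo-sibling s t<t′) (≤-trans (lo≤hi (t′ ∷ s)) (hi≤w^d (t′ ∷ s) l<d))
        (to (Sat-interval-formula x (t ∷ s)) x∈t) (to (Sat-interval-formula x (t′ ∷ s)) x∈t′)

    siblings-inconsistent : (l : ℕ) → l < d → (s : Vec (Fin w) l) → (t : Fin 2 → Fin w) →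
                            Injective _≡_ _≡_ t →
                            ¬ (Σ[ x ∈ Tuple M r ]
                                 ((i : Fin 2) → Sat M interval-formula (x ++ node-params (t i ∷ s))))
    siblings-inconsistent l l<d s t t-injective (x , x∈) with <-cmp (toℕ (t zero)) (toℕ (t (suc zero)))
    ... | tri< t₀<t₁ _ _ = siblings-disjoint l<d s t₀<t₁ x (x∈ zero) (x∈ (suc zero))
    ... | tri> _ _ t₁<t₀ = siblings-disjoint l<d s t₁<t₀ x (x∈ (suc zero)) (x∈ zero)
    ... | tri≈ _ t₀≡t₁ _ with t-injective (toℕ-injective t₀≡t₁)
    ...   | ()

  interval-formula-has-TP : IsPartialOrder _≡_ _⊑_ → LongChains _⊑_ →
                            TreeProperty M r (r + (r + arity)) interval-formula 2
  interval-formula-has-TP po chains = s≤s (s≤s z≤n) , λ d w →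
    node-params po chains d w , branch-realised po chains d w , siblings-inconsistent po chains d w

module _ {L : Signature} {M : Structure L} where

  SOP⇒¬Simple : SOP M → ¬ Simple M
  SOP⇒¬Simple (r , p , ψ , c , ⊑-refl , ⊑-antisym , ⊑-trans , chains) simple =
    simple r _ (interval-formula D) 2 (interval-formula-has-TP D po chains)
    where
    D : DefinableRel M r r (λ a b → Sat M ψ (a ++ (b ++ c)))
    D = record { formula = ψ ; params = c ; defines = λ _ _ → ⇔-refl }
    po : IsPartialOrder _≡_ (λ a b → Sat M ψ (a ++ (b ++ c)))
    po = record
      { isPreorder = record
        { isEquivalence = isEquivalence
        ; reflexive     = λ { {a} refl → ⊑-refl a }
        ; trans         = λ {a} {b} {d} → ⊑-trans a b d
        }
      ; antisym = λ {a} {b} → ⊑-antisym a b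
      }

-- Translates in a definable group

module _ {L : Signature} {M : Structure L} {k : ℕ} (𝔾 : DefinableGroup M k) where
  open DefinableGroup 𝔾

  inv-·-cancel : ∀ {h y} → G h → G y → inv h · (h · y) ≡ y
  inv-·-cancel {h} {y} Gh Gy = begin
    inv h · (h · y)   ≡⟨ sym (assoc (inv-closed Gh) Gh Gy) ⟩
    (inv h · h) · y   ≡⟨ cong (_· y) (inverseˡ Gh) ⟩
    e · y             ≡⟨ identityˡ Gy ⟩
    y                 ∎
    where open ≡-Reasoning

  ·-cancelˡ : ∀ {u a b} → G u → G a → G b → u · a ≡ u · b → a ≡ b
  ·-cancelˡ {u} Gu Ga Gb ua≡ub =
    trans (sym (inv-·-cancel Gu Ga)) (trans (cong (inv u ·_) ua≡ub) (inv-·-cancel Gu Gb))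

  power : Tuple M k → ℕ → Tuple M k
  power a zero    = e
  power a (suc n) = power a n · a

  power-closed : ∀ {a} → G a → ∀ n → G (power a n)
  power-closed Ga zero    = e-in
  power-closed Ga (suc n) = ·-closed (power-closed Ga n) Ga

  Translate : (Tuple M k → Set) → Tuple M k → Tuple M k → Set
  Translate Z v x = Σ[ y ∈ Tuple M k ] (Z y × (G v × G y × x ≡ v · y))

  translates-definable : ∀ {Z} → Definable M k Z → DefinableRel M k k (Translate Z)
  translates-definable (p , φ , c , Z⇔) with graph-definable
  ... | (q , γ , d , graph⇔) = record
    { formula = ∃ⁿ k (rename (at-y ⊕ at-c) φ ∧f rename (at-v ⊕ (at-y ⊕ (at-x ⊕ at-d))) γ)
    ; params  = c ++ d
    ; defines = λ v x → ⇔-sym (⇔-trans (Sat-∃ⁿ M k _ _) (Σ-⇔ (↠-id _) λ {y} →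
        ⇔-trans (Sat-rename M (occurs-⊕ M (occurs-++ˡ M y _) (occurs-c y v x)) φ) (⇔-sym (Z⇔ y))
        ×-⇔ ⇔-trans (Sat-rename M (occurs-⊕ M (occurs-v y v x) (occurs-⊕ M (occurs-++ˡ M y _)
                      (occurs-⊕ M (occurs-x y v x) (occurs-d y v x)))) γ) (⇔-sym (graph⇔ v y x))))
    }
    where
    n : ℕ
    n = k + (k + (k + (p + q)))
    at-y at-v at-x : Fin k → Fin n
    at-y i = i ↑ˡ _
    at-v i = k ↑ʳ (i ↑ˡ _)
    at-x i = k ↑ʳ (k ↑ʳ (i ↑ˡ _))
    at-c : Fin p → Fin n
    at-c i = k ↑ʳ (k ↑ʳ (k ↑ʳ (i ↑ˡ q)))
    at-d : Fin q → Fin n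
    at-d i = k ↑ʳ (k ↑ʳ (k ↑ʳ (p ↑ʳ i)))
    module _ (y v x : Tuple M k) where
      ρ = y ++ (v ++ (x ++ (c ++ d)))
      occurs-v : Occurs M v at-v ρ
      occurs-v = occurs-∘ M (occurs-++ʳ M y _) (occurs-++ˡ M v _)
      occurs-x : Occurs M x at-x ρ
      occurs-x = occurs-∘ M (occurs-++ʳ M y _) (occurs-∘ M (occurs-++ʳ M v _) (occurs-++ˡ M x _))
      occurs-cd : Occurs M (c ++ d) (λ i → k ↑ʳ (k ↑ʳ (k ↑ʳ i))) ρ
      occurs-cd = occurs-∘ M (occurs-++ʳ M y _) (occurs-∘ M (occurs-++ʳ M v _) (occurs-++ʳ M x _))
      occurs-c : Occurs M c at-c ρ
      occurs-c = occurs-∘ M occurs-cd (occurs-++ˡ M c d)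
      occurs-d : Occurs M d at-d ρ
      occurs-d = occurs-∘ M occurs-cd (occurs-++ʳ M c d)

  translates-shrink : ∀ {Z a w} → (∀ {y} → Z y → G y) → G a → (∀ {y} → Z y → Z (a · y)) →
                      Z w → (∀ {y} → Z y → w ≢ a · y) →
                      ∀ n → Translate Z (power a n) ⊋ Translate Z (power a (suc n))
  translates-shrink {a = a} {w} Z⊆G Ga aZ⊆Z Zw w∉aZ n =
    (λ (x , (y , Zy , _ , Gy , x≡aⁿ⁺¹y) , x∉aⁿZ) →
       x∉aⁿZ (a · y , aZ⊆Z Zy , Gaⁿ , ·-closed Ga Gy , trans x≡aⁿ⁺¹y (assoc Gaⁿ Ga Gy))) ,
    (aⁿ · w , (w , Zw , Gaⁿ , Z⊆G Zw , refl) , λ (y , Zy , _ , Gy , aⁿw≡aⁿ⁺¹y) →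
       w∉aZ Zy (·-cancelˡ Gaⁿ (Z⊆G Zw) (·-closed Ga Gy) (trans aⁿw≡aⁿ⁺¹y (assoc Gaⁿ Ga Gy))))
    where
    aⁿ = power a n
    Gaⁿ = power-closed Ga n

  -- One half of a paradoxical decomposition; the other half supplies the point outside.
  record TranslationCover (m : ℕ) : Set₁ where
    field
      X           : Fin m → Tuple M k → Set
      X-definable : ∀ i → Definable M k (X i)
      X⊆G         : ∀ i {x} → X i x → G x
      X-disjoint  : ∀ i i′ {x} → i ≢ i′ → X i x → X i′ x → ⊥
      g           : Fin m → Tuple M k
      g∈G         : ∀ i → G (g i)
      covers      : ∀ x → G x → Σ[ i ∈ Fin m ] Σ[ y ∈ Tuple M k ] (X i y × x ≡ g i · y)
      outside     : Tuple M k
      outside∈G   : G outside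
      outside∉X   : ∀ i → ¬ X i outside

  left-cover : ∀ {m n} → ParadoxicalDecomposition M 𝔾 m n → TranslationCover m
  left-cover {m} {n} D = from-witness (to (cover-Y e) e-in)
    where
    open ParadoxicalDecomposition D
    from-witness : Σ[ j ∈ Fin n ] Σ[ y ∈ Tuple M k ] (Y j y × e ≡ h j · y) → TranslationCover m
    from-witness (j , y , Yy , _) = record
      { X = X ; X-definable = X-definable ; X⊆G = X⊆G ; X-disjoint = XX-disjoint
      ; g = g ; g∈G = g∈G ; covers = λ x → to (cover-X x)
      ; outside = y ; outside∈G = Y⊆G j Yy ; outside∉X = λ i Xy → XY-disjoint i j Xy Yy
      }

  right-cover : ∀ {m n} → ParadoxicalDecomposition M 𝔾 m n → TranslationCover n
  right-cover {m} {n} D = from-witness (to (cover-X e) e-in)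
    where
    open ParadoxicalDecomposition D
    from-witness : Σ[ i ∈ Fin m ] Σ[ x ∈ Tuple M k ] (X i x × e ≡ g i · x) → TranslationCover n
    from-witness (i , x , Xx , _) = record
      { X = Y ; X-definable = Y-definable ; X⊆G = Y⊆G ; X-disjoint = YY-disjoint
      ; g = h ; g∈G = h∈G ; covers = λ y → to (cover-Y y)
      ; outside = x ; outside∈G = X⊆G i Xx ; outside∉X = λ j Yx → XY-disjoint i j Xx Yx
      }

  open TranslationCover

  cover-size≥2 : ∀ {m} → TranslationCover m → 2 ≤ m
  cover-size≥2 {zero} C with covers C e e-in
  ... | () , _
  cover-size≥2 {suc zero} C with covers C (g C zero · outside C) (·-closed (g∈G C zero) (outside∈G C))
  ... | zero , y , Xy , g₀b≡g₀y = ⊥-elim (outside∉X C zero (subst (X C zero) (sym b≡y) Xy))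
    where b≡y = ·-cancelˡ (g∈G C zero) (outside∈G C) (X⊆G C zero Xy) g₀b≡g₀y
  cover-size≥2 {suc (suc m)} C = s≤s (s≤s z≤n)

  two-piece-cover⇒SOP : TranslationCover 2 → SOP M
  two-piece-cover⇒SOP C =
    descending⇒SOP (translates-definable (definable-∖ M G-definable (X-definable C zero)))
                   (power a) (translates-shrink proj₁ Ga aZ⊆Z (outside∈G C , outside∉X₀) outside∉aZ)
    where
    X₀ X₁ : Tuple M k → Set
    X₀ = X C zero
    X₁ = X C (suc zero)
    g₀ g₁ : Tuple M k
    g₀ = g C zero
    g₁ = g C (suc zero)
    Gg₀ : G g₀
    Gg₀ = g∈G C zero
    Gg₁ : G g₁
    Gg₁ = g∈G C (suc zero)
    outside∉X₀ : ¬ X₀ (outside C)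
    outside∉X₀ = outside∉X C zero

    Z : Tuple M k → Set
    Z y = G y × ¬ X₀ y
    a : Tuple M k
    a = inv g₁ · g₀
    Ga : G a
    Ga = ·-closed (inv-closed Gg₁) Gg₀

    aZ⊆X₁ : ∀ {y} → Z y → X₁ (a · y)
    aZ⊆X₁ {y} (Gy , y∉X₀) with covers C (g₀ · y) (·-closed Gg₀ Gy)
    ... | zero , y′ , X₀y′ , g₀y≡g₀y′ = ⊥-elim (y∉X₀ (subst X₀ (sym y≡y′) X₀y′))
      where y≡y′ = ·-cancelˡ Gg₀ Gy (X⊆G C zero X₀y′) g₀y≡g₀y′
    ... | suc zero , y′ , X₁y′ , g₀y≡g₁y′ = subst X₁ (sym ay≡y′) X₁y′
      where
      open ≡-Reasoning
      ay≡y′ : a · y ≡ y′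
      ay≡y′ = begin
        (inv g₁ · g₀) · y  ≡⟨ assoc (inv-closed Gg₁) Gg₀ Gy ⟩
        inv g₁ · (g₀ · y)  ≡⟨ cong (inv g₁ ·_) g₀y≡g₁y′ ⟩
        inv g₁ · (g₁ · y′) ≡⟨ inv-·-cancel Gg₁ (X⊆G C (suc zero) X₁y′) ⟩
        y′                 ∎

    aZ⊆Z : ∀ {y} → Z y → Z (a · y)
    aZ⊆Z Zy = X⊆G C (suc zero) (aZ⊆X₁ Zy) ,
              λ X₀ay → X-disjoint C zero (suc zero) (λ ()) X₀ay (aZ⊆X₁ Zy)

    outside∉aZ : ∀ {y} → Z y → outside C ≢ a · y
    outside∉aZ Zy b≡ay = outside∉X C (suc zero) (subst X₁ (sym b≡ay) (aZ⊆X₁ Zy))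

proposition4p10 : ExcludedMiddle 0ℓ →
    ∀ {L : Signature} (M : Structure L) {k : ℕ} (G : DefinableGroup M k) →
      ((m n : ℕ) → ParadoxicalDecomposition M G m n → (m ≡ 2 ⊎ n ≡ 2) → SOP M)
      × (Simple M → DefTarskiNumber≥ M G 6)
proposition4p10 _ M 𝔾 = two-pieces⇒SOP , simple⇒Tarski≥6
  where
  two-pieces⇒SOP : (m n : ℕ) → ParadoxicalDecomposition M 𝔾 m n → (m ≡ 2 ⊎ n ≡ 2) → SOP M
  two-pieces⇒SOP _ _ D (inj₁ refl) = two-piece-cover⇒SOP 𝔾 (left-cover 𝔾 D)
  two-pieces⇒SOP _ _ D (inj₂ refl) = two-piece-cover⇒SOP 𝔾 (right-cover 𝔾 D)

  simple⇒Tarski≥6 : Simple M → DefTarskiNumber≥ M 𝔾 6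
  simple⇒Tarski≥6 simple m n D with m ≟ 2 | n ≟ 2
  ... | yes m≡2 | _       = ⊥-elim (SOP⇒¬Simple (two-pieces⇒SOP m n D (inj₁ m≡2)) simple)
  ... | no _    | yes n≡2 = ⊥-elim (SOP⇒¬Simple (two-pieces⇒SOP m n D (inj₂ n≡2)) simple)
  ... | no m≢2  | no n≢2  = +-mono-≤ (≤∧≢⇒< (cover-size≥2 𝔾 (left-cover 𝔾 D)) (m≢2 ∘ sym))
                                     (≤∧≢⇒< (cover-size≥2 𝔾 (right-cover 𝔾 D)) (n≢2 ∘ sym))
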